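{- Let $G$ be a $2$-edge-connected graph, and let $B_1,B_2$ be adjacent bases of $\operatorname{BG}(M_G)$ with $B_2=B_1-e+g$, where $e\in B_1\setminus B_2$ and $g\in B_2\setminus B_1$. Suppose the fundamental cycle $C(g,B_1)$ has length at least three. Then for each edge $w\notin B_1+g$ with both ends on $C(g,B_1)$, there exists an edge $f_w\in B_1-e$ and a good cycle $B_1B_2B_3B_4$ for $B_1B_2$ with $f_w\notin B_4$ and $w\in B_3$.
   Context: Graphs are finite and without loops; parallel edges are allowed. For such a graph $G$, the cycle matroid $M_G$ has ground set $E(G)$, and its bases are the edge sets of the spanning trees of $G$. The basis graph $\operatorname{BG}(M_G)$ has the bases as vertices, two bases $B,B'$ being adjacent if and only if $|B\triangle B'|=2$. For a spanning tree $B$ and an edge $g\notin B$, $C(g,B)$ denotes the unique cycle of $G$ contained in $B+g$. For adjacent bases $B_1,B_2$ with $B_1\setminus B_2=\{e\}$, a good cycle for $B_1B_2$ is a sequence of four distinct bases $B_1B_2B_3B_4$ forming a cycle in $\operatorname{BG}(M_G)$ (so that $B_2B_3$, $B_3B_4$ and $B_4B_1$ are edges) such that $e\in B_4$ and $e\notin B_3$. -}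

module Defs where

open import Data.Nat using (ℕ; _≤_)
open import Data.Fin using (Fin)
open import Data.Fin.Subset using (Subset; _∈_; _∉_; _⊆_; _∪_; _─_; _-_; ⁅_⁆; ∣_∣; ⊤)
open import Data.Product using (Σ; _×_; _,_; proj₁; proj₂; ∃; ∃-syntax)
open import Data.Sum using (_⊎_)
open import Data.List using (List; []; _∷_)
open import Data.List.Relation.Unary.All using (All)
open import Data.List.Relation.Unary.Unique.Propositional using (Unique)
import Data.List.Membership.Propositional as LM
open import Relation.Binary.PropositionalEquality using (_≡_; _≢_)
open import Relation.Nullary using (¬_)

record Graph : Set where
  field
    n    : ℕ
    m    : ℕ
    ends : Fin m → Fin n × Fin n
    loopless : ∀ x → proj₁ (ends x) ≢ proj₂ (ends x)

module _ (G : Graph) where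
  open Graph G

  V : Set
  V = Fin n

  E : Set
  E = Fin m

  EdgeSet : Set
  EdgeSet = Subset m

  Joins : E → V → V → Set
  Joins x u w = (ends x ≡ (u , w)) ⊎ (ends x ≡ (w , u))

  -- Walk u v es vs : a walk from u to v traversing the edges es in order;
  -- vs lists the vertices left at each step (all visited vertices except the last).
  data Walk (u : V) : V → List E → List V → Set where
    nil  : Walk u u [] []
    cons : ∀ {w v es vs} (x : E) → Joins x u w → Walk w v es vs →
           Walk u v (x ∷ es) (u ∷ vs)

  IsCycle : EdgeSet → Set
  IsCycle C = Σ V λ u → Σ E λ x → Σ (List E) λ es → Σ (List V) λ vs →
    Walk u u (x ∷ es) vs × Unique (x ∷ es) × Unique vs ×
    (∀ y → (y ∈ C → y LM.∈ (x ∷ es)) × (y LM.∈ (x ∷ es) → y ∈ C))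

  Connected : EdgeSet → Set
  Connected S = ∀ (u v : V) → Σ (List E) λ es → Σ (List V) λ vs →
    Walk u v es vs × All (λ y → y ∈ S) es

  Acyclic : EdgeSet → Set
  Acyclic S = ¬ (Σ EdgeSet λ C → IsCycle C × C ⊆ S)

  -- bases of the cycle matroid M_G = edge sets of spanning trees
  IsBasis : EdgeSet → Set
  IsBasis B = Connected B × Acyclic B

  TwoEdgeConnected : Set
  TwoEdgeConnected = Connected ⊤ × (∀ x → Connected (⊤ - x))

  Adjacent : EdgeSet → EdgeSet → Set
  Adjacent B B' = ∣ (B ─ B') ∪ (B' ─ B) ∣ ≡ 2

  OnVertexSet : V → EdgeSet → Set
  OnVertexSet v C = ∃[ y ] (y ∈ C × ((proj₁ (ends y) ≡ v) ⊎ (proj₂ (ends y) ≡ v)))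

  -- B₁B₂B₃B₄ is a good cycle for B₁B₂, where e is the element of B₁ ∖ B₂
  GoodCycle : E → EdgeSet → EdgeSet → EdgeSet → EdgeSet → Set
  GoodCycle e B₁ B₂ B₃ B₄ =
    IsBasis B₁ × IsBasis B₂ × IsBasis B₃ × IsBasis B₄ ×
    B₁ ≢ B₂ × B₁ ≢ B₃ × B₁ ≢ B₄ × B₂ ≢ B₃ × B₂ ≢ B₄ × B₃ ≢ B₄ ×
    Adjacent B₁ B₂ × Adjacent B₂ B₃ × Adjacent B₃ B₄ × Adjacent B₄ B₁ ×
    e ∈ B₄ × e ∉ B₃

-- Work with the fundamental cuts of the spanning tree B₁, each encoded as a two-colouring of the
-- vertices: B₁ - f + y is a spanning tree exactly when y crosses the cut of f, and the cuts of the
-- exchanged tree are obtained from the old ones by symmetric differences. Since B₂ = B₁ - e + g is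
-- a tree, g crosses the cut of e; and since a cycle in B₁ + g crosses every tree cut an even number
-- of times, g crosses the cut of each f ∈ B₁ whose cut separates two vertices of C. Now pick
-- f ∈ B₁ - e with g crossing its cut and w crossing the cut of e or of f: a third edge of C if w
-- crosses the cut of e, otherwise an edge of the tree path joining the ends of w. If w crosses
-- both cuts, B₁ B₂ (B₁ - e + w) (B₁ - f + w) is a good cycle; if it crosses exactly one of them,
-- B₁ B₂ (B₁ - f + g - e + w) (B₁ - f + g) is.

module Submission where

open import Algebra.Bundles using (CommutativeRing)
open import Data.Bool using (Bool; true; false; _xor_; _∧_; _∨_)
open import Data.Bool.Properties
  using (xor-same; ∧-distribˡ-xor; ∧-zeroʳ; ∧-identityʳ; xor-∧-commutativeRing)
open import Algebra.Properties.CommutativeSemigroup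
  (CommutativeRing.+-commutativeSemigroup xor-∧-commutativeRing) using (interchange)
open import Data.Empty using (⊥-elim)
open import Data.Fin using (Fin; zero; suc; _≟_)
open import Data.Fin.Properties using (any?)
open import Data.Fin.Subset
  using (Subset; inside; outside; _∈_; _∉_; _⊆_; _∪_; _─_; _-_; ⁅_⁆; ∣_∣; ⊥)
open import Data.Fin.Subset.Properties
  using (x∈p∪q⁻; x∈p∪q⁺; x∈⁅x⁆; x∈⁅y⁆⇒x≡y; ∉⊥; ⊆-antisym; p⊆q⇒∣p∣≤∣q∣; ∣⁅x⁆∣≡1;
         ∪-identityˡ; ∪-identityʳ; ∪-idem; ∪-comm; _∈?_; p─q⊆p; x∈p∧x∉q⇒x∈p─q; x∈p∧x≢y⇒x∈p-y)
open import Data.List using (List; []; _∷_; _++_)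
open import Data.List.Relation.Unary.All as All using (All; []; _∷_)
open import Data.List.Relation.Unary.All.Properties using (++⁺)
open import Data.List.Relation.Unary.Any using (here; there)
open import Data.List.Relation.Unary.AllPairs using ([]; _∷_)
open import Data.List.Relation.Unary.Unique.Propositional using (Unique)
import Data.List.Membership.Propositional as List
import Data.List.Membership.DecPropositional as DecList
open import Data.Nat using (ℕ; suc; _≤_)
open import Data.Nat.Properties using (≤-trans; ≤-reflexive; <-irrefl; n≤1+n)
open import Data.Product using (Σ; _×_; _,_; proj₁; proj₂)
open import Data.Sum using (_⊎_; inj₁; inj₂; [_,_]′)
open import Data.Vec.Base using (_∷_; here; there)
open import Relation.Binary.PropositionalEquality
  using (_≡_; _≢_; refl; sym; trans; cong; cong₂; subst; ≢-sym; module ≡-Reasoning)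
open import Relation.Nullary using (¬_; Dec; yes; no; ¬?)
open import Relation.Nullary.Decidable using (_×-dec_)

open import Defs

private
  variable
    n : ℕ
    x y z : Fin n
    p q T : Subset n

infixl 5 _+_
_+_ : Subset n → Fin n → Subset n
T + y = T ∪ ⁅ y ⁆

_△_ : Subset n → Subset n → Subset n
p △ q = (p ─ q) ∪ (q ─ p)

x∈p─q⇒x∉q : ∀ (p q : Subset n) → x ∈ p ─ q → x ∉ q
x∈p─q⇒x∉q (_ ∷ p) (inside ∷ q) ()          here
x∈p─q⇒x∉q (_ ∷ p) (_      ∷ q) (there x∈p─q) (there x∈q) = x∈p─q⇒x∉q p q x∈p─q x∈q

x∈p∧y∉p⇒x≢y : x ∈ p → y ∉ p → x ≢ y
x∈p∧y∉p⇒x≢y x∈p y∉p refl = y∉p x∈p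

x∈p∧x∉q⇒p≢q : x ∈ p → x ∉ q → p ≢ q
x∈p∧x∉q⇒p≢q x∈p x∉q refl = x∉q x∈p

x∉p∧x∈q⇒p≢q : x ∉ p → x ∈ q → p ≢ q
x∉p∧x∈q⇒p≢q x∉p x∈q p≡q = x∈p∧x∉q⇒p≢q x∈q x∉p (sym p≡q)

subset-ext : (∀ z → z ∈ p → z ∈ q) → (∀ z → z ∈ q → z ∈ p) → p ≡ q
subset-ext p⊆q q⊆p = ⊆-antisym (λ {z} → p⊆q z) (λ {z} → q⊆p z)

x∈p+y∧x≢y⇒x∈p : x ∈ p + y → x ≢ y → x ∈ p
x∈p+y∧x≢y⇒x∈p {p = p} {y = y} x∈p+y x≢y with x∈p∪q⁻ p ⁅ y ⁆ x∈p+y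
... | inj₁ x∈p   = x∈p
... | inj₂ x∈⁅y⁆ = ⊥-elim (x≢y (x∈⁅y⁆⇒x≡y y x∈⁅y⁆))

y∈T+y : y ∈ T + y
y∈T+y {y = y} = x∈p∪q⁺ (inj₂ (x∈⁅x⁆ y))

exchange⁺ : z ∈ T → z ≢ x → z ∈ T - x + y
exchange⁺ z∈T z≢x = x∈p∪q⁺ (inj₁ (x∈p∧x≢y⇒x∈p-y z∈T z≢x))

exchange⁻ : ∀ (T : Subset n) → z ∈ T - x + y → (z ∈ T × z ≢ x) ⊎ z ≡ y
exchange⁻ {x = x} {y = y} T z∈T′ with x∈p∪q⁻ (T - x) ⁅ y ⁆ z∈T′
... | inj₁ z∈T-x = inj₁ (p─q⊆p T ⁅ x ⁆ z∈T-x , λ { refl → x∈p─q⇒x∉q T ⁅ x ⁆ z∈T-x (x∈⁅x⁆ x) })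
... | inj₂ z∈⁅y⁆ = inj₂ (x∈⁅y⁆⇒x≡y y z∈⁅y⁆)

exchange-∉ : z ∉ T → z ≢ y → z ∉ T - x + y
exchange-∉ {T = T} z∉T z≢y z∈T′ = [ (λ (z∈T , _) → z∉T z∈T) , z≢y ]′ (exchange⁻ T z∈T′)

x∉T-x+y : x ≢ y → x ∉ T - x + y
x∉T-x+y {T = T} x≢y x∈T′ = [ (λ (_ , x≢x) → x≢x refl) , x≢y ]′ (exchange⁻ T x∈T′)

exchange-twice : y ∉ T → T - x + y - y + z ≡ T - x + z
exchange-twice {y = y} {T = T} {x = x} {z = z} y∉T = subset-ext forth back
  where
  forth : ∀ u → u ∈ T - x + y - y + z → u ∈ T - x + z
  forth u u∈ with exchange⁻ (T - x + y) u∈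
  ... | inj₂ refl = y∈T+y
  ... | inj₁ (u∈′ , u≢y) with exchange⁻ T u∈′
  ...   | inj₁ (u∈T , u≢x) = exchange⁺ u∈T u≢x
  ...   | inj₂ u≡y = ⊥-elim (u≢y u≡y)
  back : ∀ u → u ∈ T - x + z → u ∈ T - x + y - y + z
  back u u∈ with exchange⁻ T u∈
  ... | inj₁ (u∈T , u≢x) = exchange⁺ (exchange⁺ u∈T u≢x) (λ { refl → y∉T u∈T })
  ... | inj₂ refl = y∈T+y

exchange-restore : ∀ {x x′ y} → x ∈ T → x ≢ x′ → y ≢ x′ → T - x + y - x′ + x ≡ T - x′ + y
exchange-restore {T = T} {x} {x′} {y} x∈T x≢x′ y≢x′ = subset-ext forth back
  where
  forth : ∀ u → u ∈ T - x + y - x′ + x → u ∈ T - x′ + y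
  forth u u∈ with exchange⁻ (T - x + y) u∈
  ... | inj₂ refl = exchange⁺ x∈T x≢x′
  ... | inj₁ (u∈′ , u≢x′) with exchange⁻ T u∈′
  ...   | inj₁ (u∈T , _) = exchange⁺ u∈T u≢x′
  ...   | inj₂ refl = y∈T+y
  back : ∀ u → u ∈ T - x′ + y → u ∈ T - x + y - x′ + x
  back u u∈ with exchange⁻ T u∈
  ... | inj₂ refl = exchange⁺ y∈T+y y≢x′
  ... | inj₁ (u∈T , u≢x′) with u ≟ x
  ...   | yes refl = y∈T+y
  ...   | no u≢x = exchange⁺ (exchange⁺ u∈T u≢x) u≢x′

exchange-comm : ∀ {a b g w} → a ≢ g → b ≢ g → T - a + g - b + w ≡ T - b + g - a + w
exchange-comm {T = T} {a} {b} {g} {w} a≢g b≢g = subset-ext (forth a≢g b≢g) (forth b≢g a≢g)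
  where
  forth : ∀ {a b} → a ≢ g → b ≢ g → ∀ u → u ∈ T - a + g - b + w → u ∈ T - b + g - a + w
  forth {a} a≢g b≢g u u∈ with exchange⁻ (T - a + g) u∈
  ... | inj₂ refl = y∈T+y
  ... | inj₁ (u∈′ , u≢b) with exchange⁻ T u∈′
  ...   | inj₁ (u∈T , u≢a) = exchange⁺ (exchange⁺ u∈T u≢b) u≢a
  ...   | inj₂ refl = exchange⁺ y∈T+y (≢-sym a≢g)

∣⁅x⁆∪⁅y⁆∣≡2 : ∀ (x y : Fin n) → x ≢ y → ∣ ⁅ x ⁆ ∪ ⁅ y ⁆ ∣ ≡ 2
∣⁅x⁆∪⁅y⁆∣≡2 zero    zero    x≢y = ⊥-elim (x≢y refl)
∣⁅x⁆∪⁅y⁆∣≡2 zero    (suc y) _   = cong suc (trans (cong ∣_∣ (∪-identityˡ ⁅ y ⁆)) (∣⁅x⁆∣≡1 y))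
∣⁅x⁆∪⁅y⁆∣≡2 (suc x) zero    _   = cong suc (trans (cong ∣_∣ (∪-identityʳ ⁅ x ⁆)) (∣⁅x⁆∣≡1 x))
∣⁅x⁆∪⁅y⁆∣≡2 (suc x) (suc y) x≢y = ∣⁅x⁆∪⁅y⁆∣≡2 x y (λ eq → x≢y (cong suc eq))

△-comm : ∀ (p q : Subset n) → p △ q ≡ q △ p
△-comm p q = ∪-comm (p ─ q) (q ─ p)

T△T-x+y≡⁅x⁆∪⁅y⁆ : x ∈ T → y ∉ T → T △ (T - x + y) ≡ ⁅ x ⁆ ∪ ⁅ y ⁆
T△T-x+y≡⁅x⁆∪⁅y⁆ {x = x} {T = T} {y = y} x∈T y∉T = subset-ext forth back
  where
  x≢y : x ≢ y
  x≢y = x∈p∧y∉p⇒x≢y x∈T y∉T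
  forth : ∀ u → u ∈ T △ (T - x + y) → u ∈ ⁅ x ⁆ ∪ ⁅ y ⁆
  forth u u∈ with x∈p∪q⁻ (T ─ (T - x + y)) ((T - x + y) ─ T) u∈
  ... | inj₁ u∈T─T′ with u ≟ x
  ...   | yes refl = x∈p∪q⁺ (inj₁ (x∈⁅x⁆ u))
  ...   | no u≢x = ⊥-elim (x∈p─q⇒x∉q T _ u∈T─T′ (exchange⁺ (p─q⊆p T _ u∈T─T′) u≢x))
  forth u u∈ | inj₂ u∈T′─T with exchange⁻ T (p─q⊆p _ T u∈T′─T)
  ...   | inj₁ (u∈T , _) = ⊥-elim (x∈p─q⇒x∉q _ T u∈T′─T u∈T)
  ...   | inj₂ refl = x∈p∪q⁺ (inj₂ (x∈⁅x⁆ u))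
  back : ∀ u → u ∈ ⁅ x ⁆ ∪ ⁅ y ⁆ → u ∈ T △ (T - x + y)
  back u u∈ with x∈p∪q⁻ ⁅ x ⁆ ⁅ y ⁆ u∈
  ... | inj₁ u∈⁅x⁆ rewrite x∈⁅y⁆⇒x≡y x u∈⁅x⁆ = x∈p∪q⁺ (inj₁ (x∈p∧x∉q⇒x∈p─q x∈T (x∉T-x+y x≢y)))
  ... | inj₂ u∈⁅y⁆ rewrite x∈⁅y⁆⇒x≡y y u∈⁅y⁆ = x∈p∪q⁺ (inj₂ (x∈p∧x∉q⇒x∈p─q y∈T+y y∉T))

∣T△T-x+y∣≡2 : x ∈ T → y ∉ T → ∣ T △ (T - x + y) ∣ ≡ 2
∣T△T-x+y∣≡2 {x = x} {y = y} x∈T y∉T =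
  trans (cong ∣_∣ (T△T-x+y≡⁅x⁆∪⁅y⁆ x∈T y∉T)) (∣⁅x⁆∪⁅y⁆∣≡2 x y (x∈p∧y∉p⇒x≢y x∈T y∉T))

∣p∣≥3⇒∃∉⁅x,y⁆ : ∀ (p : Subset n) x y → 3 ≤ ∣ p ∣ → Σ (Fin n) λ z → z ∈ p × z ≢ x × z ≢ y
∣p∣≥3⇒∃∉⁅x,y⁆ p x y 3≤∣p∣ with any? (λ z → (z ∈? p) ×-dec (¬? (z ≟ x) ×-dec ¬? (z ≟ y)))
... | yes found = found
... | no none = ⊥-elim (<-irrefl refl (≤-trans 3≤∣p∣ ∣p∣≤2))
  where
  p⊆⁅x⁆∪⁅y⁆ : p ⊆ ⁅ x ⁆ ∪ ⁅ y ⁆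
  p⊆⁅x⁆∪⁅y⁆ {z} z∈p with z ≟ x | z ≟ y
  ... | yes refl | _        = x∈p∪q⁺ (inj₁ (x∈⁅x⁆ z))
  ... | no _     | yes refl = x∈p∪q⁺ (inj₂ (x∈⁅x⁆ z))
  ... | no z≢x   | no z≢y   = ⊥-elim (none (z , z∈p , z≢x , z≢y))
  ∣⁅x⁆∪⁅y⁆∣≤2 : ∣ ⁅ x ⁆ ∪ ⁅ y ⁆ ∣ ≤ 2
  ∣⁅x⁆∪⁅y⁆∣≤2 with x ≟ y
  ... | yes refl = ≤-trans (≤-reflexive (trans (cong ∣_∣ (∪-idem ⁅ x ⁆)) (∣⁅x⁆∣≡1 x))) (n≤1+n 1)
  ... | no x≢y   = ≤-reflexive (∣⁅x⁆∪⁅y⁆∣≡2 x y x≢y)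
  ∣p∣≤2 : ∣ p ∣ ≤ 2
  ∣p∣≤2 = ≤-trans (p⊆q⇒∣p∣≤∣q∣ p⊆⁅x⁆∪⁅y⁆) ∣⁅x⁆∪⁅y⁆∣≤2

xor≡false⇒≡ : ∀ a b → a xor b ≡ false → a ≡ b
xor≡false⇒≡ true  true  _ = refl
xor≡false⇒≡ false false _ = refl

xor≡true⇒≢ : ∀ a b → a xor b ≡ true → a ≢ b
xor≡true⇒≢ a .a a⊕a≡true refl with () ← trans (sym a⊕a≡true) (xor-same a)

≢⇒xor≡true : ∀ a b → a ≢ b → a xor b ≡ true
≢⇒xor≡true true  true  a≢b = ⊥-elim (a≢b refl)
≢⇒xor≡true true  false _   = refl
≢⇒xor≡true false true  _   = refl
≢⇒xor≡true false false a≢b = ⊥-elim (a≢b refl)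

module _ (Gr : Graph) where
  open Graph Gr

  private
    variable
      P Q : E Gr → Set
      u v w t : V Gr

  end₁ end₂ : E Gr → V Gr
  end₁ x = proj₁ (ends x)
  end₂ x = proj₂ (ends x)

  IsEnd : E Gr → V Gr → Set
  IsEnd x t = end₁ x ≡ t ⊎ end₂ x ≡ t

  joins-sym : Joins Gr x u w → Joins Gr x w u
  joins-sym (inj₁ eq) = inj₂ eq
  joins-sym (inj₂ eq) = inj₁ eq

  joins⇒isEnd₁ : Joins Gr x u w → IsEnd x u
  joins⇒isEnd₁ (inj₁ eq) = inj₁ (cong proj₁ eq)
  joins⇒isEnd₁ (inj₂ eq) = inj₂ (cong proj₂ eq)

  joins⇒isEnd₂ : Joins Gr x u w → IsEnd x w
  joins⇒isEnd₂ j = joins⇒isEnd₁ (joins-sym j)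

  isEnd⇒joined : Joins Gr x u w → IsEnd x t → t ≡ u ⊎ t ≡ w
  isEnd⇒joined (inj₁ refl) (inj₁ refl) = inj₁ refl
  isEnd⇒joined (inj₁ refl) (inj₂ refl) = inj₂ refl
  isEnd⇒joined (inj₂ refl) (inj₁ refl) = inj₂ refl
  isEnd⇒joined (inj₂ refl) (inj₂ refl) = inj₁ refl

  WalkIn : (E Gr → Set) → V Gr → V Gr → Set
  WalkIn P u v = Σ (List (E Gr)) λ es → Σ (List (V Gr)) λ vs → Walk Gr u v es vs × All P es

  []ʷ : WalkIn P u u
  []ʷ = [] , [] , nil , []

  edgeʷ : Joins Gr x u w → P x → WalkIn P u w
  edgeʷ {x = x} j px = x ∷ [] , _ , cons x j nil , px ∷ []

  alongʷ : ∀ x → P x → WalkIn P (end₁ x) (end₂ x)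
  alongʷ x = edgeʷ (inj₁ refl)

  walk-++ : ∀ {es vs fs ws} → Walk Gr u v es vs → Walk Gr v t fs ws → Walk Gr u t (es ++ fs) (vs ++ ws)
  walk-++ nil r = r
  walk-++ (cons x j r) r′ = cons x j (walk-++ r r′)

  infixr 5 _++ʷ_
  _++ʷ_ : WalkIn P u v → WalkIn P v t → WalkIn P u t
  (es , vs , r , a) ++ʷ (fs , ws , r′ , a′) = es ++ fs , vs ++ ws , walk-++ r r′ , ++⁺ a a′

  reverseʷ : WalkIn P u v → WalkIn P v u
  reverseʷ (_ , _ , nil , []) = []ʷ
  reverseʷ (_ , _ , cons x j r , px ∷ a) = reverseʷ (_ , _ , r , a) ++ʷ edgeʷ (joins-sym j) px

  mapʷ : (∀ {y} → P y → Q y) → WalkIn P u v → WalkIn Q u v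
  mapʷ f (es , vs , r , a) = es , vs , r , All.map f a

  Avoiding : EdgeSet Gr → E Gr → E Gr → Set
  Avoiding T x y = y ∈ T × y ≢ x

  split-after-last : ∀ x {es vs} → Walk Gr u v es vs → All P es →
    WalkIn (λ y → P y × y ≢ x) u v ⊎ Σ (V Gr) λ t → IsEnd x t × WalkIn (λ y → P y × y ≢ x) t v
  split-after-last x nil [] = inj₁ []ʷ
  split-after-last x (cons y j r) (py ∷ a) with split-after-last x r a
  ... | inj₂ tail = inj₂ tail
  ... | inj₁ (es , vs , r′ , a′) with y ≟ x
  ...   | yes refl = inj₂ (_ , joins⇒isEnd₂ j , es , vs , r′ , a′)
  ...   | no y≢x = inj₁ (y ∷ es , _ , cons y j r′ , (py , y≢x) ∷ a′)

  split-at : ∀ {es vs} → Walk Gr u v es vs → All P es → Unique es → y List.∈ es →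
    Σ (V Gr) λ t → Σ (V Gr) λ t′ →
      WalkIn (λ z → P z × z ≢ y) u t × Joins Gr y t t′ × WalkIn (λ z → P z × z ≢ y) t′ v
  split-at (cons x j r) (px ∷ a) (x∉es ∷ _) (here refl) =
    _ , _ , []ʷ , j , (_ , _ , r , All.zipWith (λ (pz , x≢z) → pz , ≢-sym x≢z) (a , x∉es))
  split-at (cons x j r) (px ∷ a) (x∉es ∷ ues) (there y∈es) with split-at r a ues y∈es
  ... | t , t′ , (es , vs , r₁ , a₁) , j′ , rest =
    t , t′ , (x ∷ es , _ , cons x j r₁ , (px , All.lookup x∉es y∈es) ∷ a₁) , j′ , rest

  start-visited : ∀ {es vs} → Walk Gr u v es vs → u List.∈ vs ⊎ u ≡ v
  start-visited nil = inj₂ refl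
  start-visited (cons x j r) = inj₁ (here refl)

  end-visited : ∀ {es vs} → Walk Gr u v es vs → y List.∈ es → IsEnd y t → t List.∈ vs ⊎ t ≡ v
  end-visited (cons x j r) (here refl) t-end with isEnd⇒joined j t-end
  ... | inj₁ refl = inj₁ (here refl)
  ... | inj₂ refl with start-visited r
  ...   | inj₁ t∈vs = inj₁ (there t∈vs)
  ...   | inj₂ t≡v = inj₂ t≡v
  end-visited (cons x j r) (there y∈es) t-end with end-visited r y∈es t-end
  ... | inj₁ t∈vs = inj₁ (there t∈vs)
  ... | inj₂ t≡v = inj₂ t≡v

  PathIn : (E Gr → Set) → V Gr → V Gr → Set
  PathIn P u v = Σ (List (E Gr)) λ es → Σ (List (V Gr)) λ vs →
    Walk Gr u v es vs × All P es × Unique es × Unique vs × ¬ (v List.∈ vs)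

  path-suffix : ∀ {es vs} → Walk Gr w v es vs → All P es → Unique es → Unique vs →
    ¬ (v List.∈ vs) → u List.∈ vs → PathIn P u v
  path-suffix r@(cons _ _ _) a ues uvs v∉vs (here refl) = _ , _ , r , a , ues , uvs , v∉vs
  path-suffix (cons _ _ r) (_ ∷ a) (_ ∷ ues) (_ ∷ uvs) v∉vs (there u∈vs) =
    path-suffix r a ues uvs (λ v∈ → v∉vs (there v∈)) u∈vs

  walk⇒path : ∀ {es vs} → Walk Gr u v es vs → All P es → PathIn P u v
  walk⇒path nil [] = [] , [] , nil , [] , [] , [] , λ ()
  walk⇒path {u = u} {v = v} (cons x j r) (px ∷ a) with walk⇒path r a
  ... | es , vs , r′ , a′ , ues , uvs , v∉vs with u ≟ v
  ...   | yes refl = [] , [] , nil , [] , [] , [] , λ ()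
  ...   | no u≢v with DecList._∈?_ _≟_ u vs
  ...     | yes u∈vs = path-suffix r′ a′ ues uvs v∉vs u∈vs
  ...     | no u∉vs = x ∷ es , u ∷ vs , cons x j r′ , px ∷ a′ ,
                      All.tabulate x∉es ∷ ues , All.tabulate (λ { u′∈vs refl → u∉vs u′∈vs }) ∷ uvs ,
                      λ { (here v≡u) → u≢v (sym v≡u) ; (there v∈vs) → v∉vs v∈vs }
    where
    x∉es : ∀ {y} → y List.∈ es → x ≢ y
    x∉es y∈es refl = [ u∉vs , u≢v ]′ (end-visited r′ y∈es (joins⇒isEnd₁ j))

  fromList : List (E Gr) → EdgeSet Gr
  fromList [] = ⊥
  fromList (y ∷ ys) = ⁅ y ⁆ ∪ fromList ys

  ∈-fromList⁺ : ∀ {ys} → y List.∈ ys → y ∈ fromList ys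
  ∈-fromList⁺ (here refl) = x∈p∪q⁺ (inj₁ (x∈⁅x⁆ _))
  ∈-fromList⁺ (there y∈ys) = x∈p∪q⁺ (inj₂ (∈-fromList⁺ y∈ys))

  ∈-fromList⁻ : ∀ ys → y ∈ fromList ys → y List.∈ ys
  ∈-fromList⁻ [] y∈ = ⊥-elim (∉⊥ y∈)
  ∈-fromList⁻ (z ∷ ys) y∈ with x∈p∪q⁻ ⁅ z ⁆ (fromList ys) y∈
  ... | inj₁ y∈⁅z⁆ = here (x∈⁅y⁆⇒x≡y z y∈⁅z⁆)
  ... | inj₂ y∈zs = there (∈-fromList⁻ ys y∈zs)

  acyclic⇒no-bypass : Acyclic Gr T → x ∈ T → ¬ WalkIn (Avoiding T x) (end₂ x) (end₁ x)
  acyclic⇒no-bypass {T = T} {x = x} acyclic x∈T (_ , _ , r , a) with walk⇒path r a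
  ... | es , vs , r′ , a′ , ues , uvs , v∉vs =
    acyclic (fromList (x ∷ es) ,
             (end₁ x , x , es , end₁ x ∷ vs , cons x (inj₁ refl) r′ ,
              All.tabulate x∉es ∷ ues , All.tabulate (λ { u∈vs refl → v∉vs u∈vs }) ∷ uvs ,
              λ y → ∈-fromList⁻ (x ∷ es) , ∈-fromList⁺) ,
             cycle⊆T)
    where
    x∉es : ∀ {y} → y List.∈ es → x ≢ y
    x∉es y∈es refl = proj₂ (All.lookup a′ y∈es) refl
    cycle⊆T : fromList (x ∷ es) ⊆ T
    cycle⊆T {y} y∈ with ∈-fromList⁻ (x ∷ es) y∈
    ... | here refl = x∈T
    ... | there y∈es = proj₁ (All.lookup a′ y∈es)

  crosses : (V Gr → Bool) → E Gr → Bool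
  crosses c y = c (end₁ y) xor c (end₂ y)

  module _ (c : V Gr → Bool) where

    joins-same-side : Joins Gr x u w → crosses c x ≡ false → c u ≡ c w
    joins-same-side (inj₁ refl) x-stays = xor≡false⇒≡ _ _ x-stays
    joins-same-side (inj₂ refl) x-stays = sym (xor≡false⇒≡ _ _ x-stays)

    joins-separates : Joins Gr x u w → crosses c x ≡ true → c u ≢ c w
    joins-separates (inj₁ refl) x-crosses = xor≡true⇒≢ _ _ x-crosses
    joins-separates (inj₂ refl) x-crosses = ≢-sym (xor≡true⇒≢ _ _ x-crosses)

    walk-same-side : ∀ {es vs} → Walk Gr u v es vs → All (λ y → crosses c y ≡ false) es → c u ≡ c v
    walk-same-side nil [] = refl
    walk-same-side (cons x j r) (x-stays ∷ a) = trans (joins-same-side j x-stays) (walk-same-side r a)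

    walk-same-side-visited : ∀ {es vs} → Walk Gr u v es vs → All (λ y → crosses c y ≡ false) es →
      t List.∈ vs → c u ≡ c t
    walk-same-side-visited (cons x j r) _ (here refl) = refl
    walk-same-side-visited (cons x j r) (x-stays ∷ a) (there t∈vs) =
      trans (joins-same-side j x-stays) (walk-same-side-visited r a t∈vs)

    walkIn-same-side : (∀ {y} → P y → crosses c y ≡ false) → WalkIn P u v → c u ≡ c v
    walkIn-same-side P⇒stays (_ , _ , r , a) = walk-same-side r (All.map P⇒stays a)

    connected-same-side : Connected Gr T → (∀ y → y ∈ T → crosses c y ≡ false) → c u ≡ c v
    connected-same-side {u = u} {v = v} T-connected T-stays =
      walkIn-same-side (λ {y} → T-stays y) (T-connected u v)

    cycle-not-crossed-once : ∀ {C z} → IsCycle Gr C → z ∈ C → crosses c z ≡ true →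
      ¬ (∀ y → y ∈ C → y ≢ z → crosses c y ≡ false)
    cycle-not-crossed-once {C = C} {z = z} (_ , _ , _ , _ , r , ues , _ , C≈es) z∈C z-crosses others-stay
      with split-at r (All.tabulate (proj₂ (C≈es _))) ues (proj₁ (C≈es z) z∈C)
    ... | t , t′ , before , j , after =
      joins-separates j z-crosses
        (trans (sym (walkIn-same-side stays before)) (sym (walkIn-same-side stays after)))
      where
      stays : ∀ {y} → y ∈ C × y ≢ z → crosses c y ≡ false
      stays (y∈C , y≢z) = others-stay _ y∈C y≢z

    cycle-same-side : ∀ {C} → IsCycle Gr C → (∀ y → y ∈ C → crosses c y ≡ false) →
      OnVertexSet Gr u C → OnVertexSet Gr v C → c u ≡ c v
    cycle-same-side {C = C} (s , x , es , vs , r , _ , _ , C≈es) C-stays u-on v-on =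
      trans (sym (from-start u-on)) (from-start v-on)
      where
      stays : All (λ y → crosses c y ≡ false) (x ∷ es)
      stays = All.tabulate (λ y∈ → C-stays _ (proj₂ (C≈es _) y∈))
      from-start : ∀ {t} → OnVertexSet Gr t C → c s ≡ c t
      from-start (y , y∈C , t-end) with end-visited r (proj₁ (C≈es y) y∈C) t-end
      ... | inj₁ t∈vs = walk-same-side-visited r stays t∈vs
      ... | inj₂ refl = refl

  crosses-xor-∧ : ∀ c b d y → crosses (λ v → c v xor (b ∧ d v)) y ≡ crosses c y xor (b ∧ crosses d y)
  crosses-xor-∧ c b d y = begin
    (c₁ xor (b ∧ d₁)) xor (c₂ xor (b ∧ d₂))  ≡⟨ interchange c₁ (b ∧ d₁) c₂ (b ∧ d₂) ⟩
    (c₁ xor c₂) xor ((b ∧ d₁) xor (b ∧ d₂))  ≡⟨ cong ((c₁ xor c₂) xor_) (∧-distribˡ-xor b d₁ d₂) ⟨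
    (c₁ xor c₂) xor (b ∧ (d₁ xor d₂))        ∎
    where
    open ≡-Reasoning
    c₁ = c (end₁ y)
    c₂ = c (end₂ y)
    d₁ = d (end₁ y)
    d₂ = d (end₂ y)

  record FundamentalCuts (T : EdgeSet Gr) (cut : E Gr → V Gr → Bool) : Set where
    field
      connected     : Connected Gr T
      crosses-own   : ∀ x → x ∈ T → crosses (cut x) x ≡ true
      crosses-other : ∀ x y → x ∈ T → y ∈ T → y ≢ x → crosses (cut x) y ≡ false

  fundamentalCuts⇒basis : ∀ {cut} → FundamentalCuts T cut → IsBasis Gr T
  fundamentalCuts⇒basis {T = T} {cut} cuts = connected , acyclic
    where
    open FundamentalCuts cuts
    acyclic : Acyclic Gr T
    acyclic (C , C-cycle@(_ , x , _ , _ , _ , _ , _ , C≈es) , C⊆T) =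
      cycle-not-crossed-once (cut x) C-cycle x∈C (crosses-own x (C⊆T x∈C))
        (λ y y∈C y≢x → crosses-other x y (C⊆T x∈C) (C⊆T y∈C) y≢x)
      where
      x∈C : x ∈ C
      x∈C = proj₂ (C≈es x) (here refl)

  endAt : E Gr → Bool → V Gr
  endAt x false = end₁ x
  endAt x true  = end₂ x

  reach-avoiding : Connected Gr T → ∀ x v → Σ Bool λ s → WalkIn (Avoiding T x) (endAt x s) v
  reach-avoiding T-connected x v with T-connected (end₁ x) v
  ... | _ , _ , r , a with split-after-last x r a
  ...   | inj₁ walk                  = false , walk
  ...   | inj₂ (_ , inj₁ refl , walk) = false , walk
  ...   | inj₂ (_ , inj₂ refl , walk) = true , walk

  side : Connected Gr T → E Gr → V Gr → Bool
  side T-connected x v = proj₁ (reach-avoiding T-connected x v)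

  basis⇒fundamentalCuts : (B : IsBasis Gr T) → FundamentalCuts T (side (proj₁ B))
  basis⇒fundamentalCuts {T = T} (T-connected , T-acyclic) = record
    { connected = T-connected ; crosses-own = crosses-own ; crosses-other = crosses-other }
    where
    side-end₁ : ∀ x → x ∈ T → side T-connected x (end₁ x) ≡ false
    side-end₁ x x∈T with reach-avoiding T-connected x (end₁ x)
    ... | false , _    = refl
    ... | true  , walk = ⊥-elim (acyclic⇒no-bypass T-acyclic x∈T walk)

    side-end₂ : ∀ x → x ∈ T → side T-connected x (end₂ x) ≡ true
    side-end₂ x x∈T with reach-avoiding T-connected x (end₂ x)
    ... | true  , _    = refl
    ... | false , walk = ⊥-elim (acyclic⇒no-bypass T-acyclic x∈T (reverseʷ walk))

    crosses-own : ∀ x → x ∈ T → crosses (side T-connected x) x ≡ true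
    crosses-own x x∈T rewrite side-end₁ x x∈T | side-end₂ x x∈T = refl

    crosses-other : ∀ x y → x ∈ T → y ∈ T → y ≢ x → crosses (side T-connected x) y ≡ false
    crosses-other x y x∈T y∈T y≢x
      with reach-avoiding T-connected x (end₁ y) | reach-avoiding T-connected x (end₂ y)
    ... | false , _    | false , _    = refl
    ... | true  , _    | true  , _    = refl
    ... | false , walk₁ | true , walk₂ =
      ⊥-elim (acyclic⇒no-bypass T-acyclic x∈T (reverseʷ (walk₁ ++ʷ alongʷ y (y∈T , y≢x) ++ʷ reverseʷ walk₂)))
    ... | true , walk₁ | false , walk₂ =
      ⊥-elim (acyclic⇒no-bypass T-acyclic x∈T (walk₁ ++ʷ alongʷ y (y∈T , y≢x) ++ʷ reverseʷ walk₂))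

  connected-transfer : ∀ {S} → Connected Gr T → (∀ y → y ∈ T → WalkIn (_∈ S) (end₁ y) (end₂ y)) →
    Connected Gr S
  connected-transfer {T = T} {S} T-connected bridge u v = reroute (T-connected u v)
    where
    reroute : ∀ {u v} → WalkIn (_∈ T) u v → WalkIn (_∈ S) u v
    reroute (_ , _ , nil , []) = []ʷ
    reroute (_ , _ , cons y (inj₁ refl) r , y∈T ∷ a) = bridge y y∈T ++ʷ reroute (_ , _ , r , a)
    reroute (_ , _ , cons y (inj₂ refl) r , y∈T ∷ a) = reverseʷ (bridge y y∈T) ++ʷ reroute (_ , _ , r , a)

  -- The fundamental cut of z in T - x + y is the symmetric difference of those of z and x
  -- in T when y crosses the former, and unchanged otherwise; y inherits the cut of x.
  exchangeCuts : (E Gr → V Gr → Bool) → E Gr → E Gr → E Gr → V Gr → Bool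
  exchangeCuts cut x y z with z ≟ y
  ... | yes _ = cut x
  ... | no _  = λ v → cut z v xor (crosses (cut z) y ∧ cut x v)

  exchangeCuts-added : ∀ cut x y → exchangeCuts cut x y y ≡ cut x
  exchangeCuts-added cut x y with y ≟ y
  ... | yes _  = refl
  ... | no y≢y = ⊥-elim (y≢y refl)

  crosses-exchangeCuts : ∀ cut x y z → z ≢ y → ∀ w →
    crosses (exchangeCuts cut x y z) w ≡ crosses (cut z) w xor (crosses (cut z) y ∧ crosses (cut x) w)
  crosses-exchangeCuts cut x y z z≢y w with z ≟ y
  ... | yes z≡y = ⊥-elim (z≢y z≡y)
  ... | no _    = crosses-xor-∧ (cut z) (crosses (cut z) y) (cut x) w

  exchange-fundamentalCuts : ∀ {cut} → FundamentalCuts T cut → x ∈ T → y ∉ T → crosses (cut x) y ≡ true →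
    FundamentalCuts (T - x + y) (exchangeCuts cut x y)
  exchange-fundamentalCuts {T = T} {x = x} {y = y} {cut} cuts x∈T y∉T y-crosses = record
    { connected = connected-transfer connected bridge
    ; crosses-own = crosses-own′ ; crosses-other = crosses-other′ }
    where
    open FundamentalCuts cuts

    y≢ : ∀ {z} → z ∈ T → z ≢ y
    y≢ z∈T refl = y∉T z∈T

    into : ∀ {z} → Avoiding T x z → z ∈ T - x + y
    into (z∈T , z≢x) = exchange⁺ z∈T z≢x

    side-of-end : ∀ s {v} → WalkIn (Avoiding T x) (endAt x s) v → cut x (endAt x s) ≡ cut x v
    side-of-end _ = walkIn-same-side (cut x) (λ (z∈T , z≢x) → crosses-other x _ x∈T z∈T z≢x)

    -- As y crosses the cut of x, its ends are reached in T - x from different ends of x.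
    bypass : WalkIn (_∈ T - x + y) (end₁ x) (end₂ x)
    bypass with reach-avoiding connected x (end₁ y) | reach-avoiding connected x (end₂ y)
    ... | false , walk₁ | false , walk₂ =
      ⊥-elim (xor≡true⇒≢ _ _ y-crosses (trans (sym (side-of-end false walk₁)) (side-of-end false walk₂)))
    ... | true , walk₁ | true , walk₂ =
      ⊥-elim (xor≡true⇒≢ _ _ y-crosses (trans (sym (side-of-end true walk₁)) (side-of-end true walk₂)))
    ... | false , walk₁ | true , walk₂ =
      mapʷ into walk₁ ++ʷ alongʷ y y∈T+y ++ʷ reverseʷ (mapʷ into walk₂)
    ... | true , walk₁ | false , walk₂ =
      reverseʷ (mapʷ into walk₁ ++ʷ alongʷ y y∈T+y ++ʷ reverseʷ (mapʷ into walk₂))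

    bridge : ∀ z → z ∈ T → WalkIn (_∈ T - x + y) (end₁ z) (end₂ z)
    bridge z z∈T with z ≟ x
    ... | yes refl = bypass
    ... | no z≢x   = alongʷ z (exchange⁺ z∈T z≢x)

    crosses-own′ : ∀ z → z ∈ T - x + y → crosses (exchangeCuts cut x y z) z ≡ true
    crosses-own′ z z∈T′ with exchange⁻ T z∈T′
    ... | inj₂ refl = trans (cong (λ c → crosses c z) (exchangeCuts-added cut x z)) y-crosses
    ... | inj₁ (z∈T , z≢x)
      rewrite crosses-exchangeCuts cut x y z (y≢ z∈T) z
            | crosses-own z z∈T | crosses-other x z x∈T z∈T z≢x | ∧-zeroʳ (crosses (cut z) y) = refl

    crosses-other′ : ∀ z z′ → z ∈ T - x + y → z′ ∈ T - x + y → z′ ≢ z →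
      crosses (exchangeCuts cut x y z) z′ ≡ false
    crosses-other′ z z′ z∈T′ z′∈T′ z′≢z with exchange⁻ T z∈T′ | exchange⁻ T z′∈T′
    ... | inj₂ refl | inj₂ refl = ⊥-elim (z′≢z refl)
    ... | inj₂ refl | inj₁ (z′∈T , z′≢x) =
      trans (cong (λ c → crosses c z′) (exchangeCuts-added cut x z)) (crosses-other x z′ x∈T z′∈T z′≢x)
    ... | inj₁ (z∈T , z≢x) | inj₂ refl
      rewrite crosses-exchangeCuts cut x y z (y≢ z∈T) y | y-crosses
            | ∧-identityʳ (crosses (cut z) y) = xor-same (crosses (cut z) y)
    ... | inj₁ (z∈T , z≢x) | inj₁ (z′∈T , z′≢x)
      rewrite crosses-exchangeCuts cut x y z (y≢ z∈T) z′
            | crosses-other z z′ z∈T z′∈T z′≢z | crosses-other x z′ x∈T z′∈T z′≢x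
            | ∧-zeroʳ (crosses (cut z) y) = refl

  exchange-connected⇒crosses : ∀ {cut} → FundamentalCuts T cut → x ∈ T →
    Connected Gr (T - x + y) → crosses (cut x) y ≡ true
  exchange-connected⇒crosses {T = T} {x = x} {y = y} {cut} cuts x∈T T′-connected
    with crosses (cut x) y in y-crossing
  ... | true  = refl
  ... | false =
    ⊥-elim (xor≡true⇒≢ _ _ (crosses-own x x∈T) (connected-same-side (cut x) T′-connected stays))
    where
    open FundamentalCuts cuts
    stays : ∀ z → z ∈ T - x + y → crosses (cut x) z ≡ false
    stays z z∈T′ with exchange⁻ T z∈T′
    ... | inj₁ (z∈T , z≢x) = crosses-other x z x∈T z∈T z≢x
    ... | inj₂ refl        = y-crossing

  separating-cut : ∀ {cut} → FundamentalCuts T cut → u ≢ v → Σ (E Gr) λ f → f ∈ T × cut f u ≢ cut f v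
  separating-cut {u = u} {v = v} {cut} cuts u≢v with FundamentalCuts.connected cuts u v
  ... | _ , _ , r , a with walk⇒path r a
  ...   | [] , _ , nil , _ = ⊥-elim (u≢v refl)
  ...   | f ∷ _ , _ , cons .f j rest , f∈T ∷ a′ , f∉rest ∷ _ , _ =
    f , f∈T , λ same → joins-separates (cut f) j (crosses-own f f∈T) (trans same (sym rest-same-side))
    where
    open FundamentalCuts cuts
    rest-same-side : cut f _ ≡ cut f v
    rest-same-side = walk-same-side (cut f) rest
      (All.zipWith (λ (y∈T , f≢y) → crosses-other f _ f∈T y∈T (≢-sym f≢y)) (a′ , f∉rest))

  -- A cycle meets every cut an even number of times, and its edges other than f and g do not
  -- cross the cut of f.
  cycle-separated⇒crosses : ∀ {cut C f g} → FundamentalCuts T cut → IsCycle Gr C → C ⊆ T + g → f ∈ T →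
    OnVertexSet Gr u C → OnVertexSet Gr v C → cut f u ≢ cut f v → crosses (cut f) g ≡ true
  cycle-separated⇒crosses {T = T} {cut = cut} {C} {f} {g} cuts C-cycle C⊆T+g f∈T u-on v-on separated
    with crosses (cut f) g in g-crossing
  ... | true  = refl
  ... | false = ⊥-elim (impossible (f ∈? C))
    where
    open FundamentalCuts cuts
    others-stay : ∀ y → y ∈ C → y ≢ f → crosses (cut f) y ≡ false
    others-stay y y∈C y≢f with x∈p∪q⁻ T ⁅ g ⁆ (C⊆T+g y∈C)
    ... | inj₁ y∈T = crosses-other f y f∈T y∈T y≢f
    ... | inj₂ y∈⁅g⁆ rewrite x∈⁅y⁆⇒x≡y g y∈⁅g⁆ = g-crossing
    impossible : ¬ Dec (f ∈ C)
    impossible (yes f∈C) = cycle-not-crossed-once (cut f) C-cycle f∈C (crosses-own f f∈T) others-stay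
    impossible (no f∉C)  =
      separated (cycle-same-side (cut f) C-cycle
        (λ y y∈C → others-stay y y∈C λ { refl → f∉C y∈C }) u-on v-on)

  GoodCycleThrough : E Gr → EdgeSet Gr → EdgeSet Gr → E Gr → Set
  GoodCycleThrough e B₁ B₂ w = Σ (E Gr) λ f → f ∈ B₁ × f ≢ e ×
    Σ (EdgeSet Gr) λ B₃ → Σ (EdgeSet Gr) λ B₄ → GoodCycle Gr e B₁ B₂ B₃ B₄ × f ∉ B₄ × w ∈ B₃

  module GoodCycles {B₁ cut} {e g w : E Gr} (cuts : FundamentalCuts B₁ cut)
    (B₂-basis : IsBasis Gr (B₁ - e + g)) (e∈B₁ : e ∈ B₁) (g∉B₁ : g ∉ B₁) (w∉B₁ : w ∉ B₁) (w≢g : w ≢ g)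
    where

    private
      B₁-basis : IsBasis Gr B₁
      B₁-basis = fundamentalCuts⇒basis cuts
      e≢g : e ≢ g
      e≢g = x∈p∧y∉p⇒x≢y e∈B₁ g∉B₁
      e≢w : e ≢ w
      e≢w = x∈p∧y∉p⇒x≢y e∈B₁ w∉B₁
      g-crosses-e : crosses (cut e) g ≡ true
      g-crosses-e = exchange-connected⇒crosses cuts e∈B₁ (proj₁ B₂-basis)

    good-cycle-via-w : ∀ {f} → f ∈ B₁ → f ≢ e →
      crosses (cut e) w ≡ true → crosses (cut f) w ≡ true → GoodCycleThrough e B₁ (B₁ - e + g) w
    good-cycle-via-w {f} f∈B₁ f≢e w-crosses-e w-crosses-f =
      f , f∈B₁ , f≢e , B₁ - e + w , B₁ - f + w ,
      ( B₁-basis , B₂-basis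
      , fundamentalCuts⇒basis (exchange-fundamentalCuts cuts e∈B₁ w∉B₁ w-crosses-e)
      , fundamentalCuts⇒basis (exchange-fundamentalCuts cuts f∈B₁ w∉B₁ w-crosses-f)
      , x∉p∧x∈q⇒p≢q g∉B₁ y∈T+y , x∉p∧x∈q⇒p≢q w∉B₁ y∈T+y , x∉p∧x∈q⇒p≢q w∉B₁ y∈T+y
      , x∈p∧x∉q⇒p≢q y∈T+y g∉B₁-e+w , x∈p∧x∉q⇒p≢q y∈T+y g∉B₁-f+w
      , x∉p∧x∈q⇒p≢q (x∉T-x+y e≢w) e∈B₁-f+w
      , ∣T△T-x+y∣≡2 e∈B₁ g∉B₁
      , subst (λ B → ∣ (B₁ - e + g) △ B ∣ ≡ 2) (exchange-twice g∉B₁)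
          (∣T△T-x+y∣≡2 y∈T+y (exchange-∉ w∉B₁ w≢g))
      , subst (λ B → ∣ (B₁ - e + w) △ B ∣ ≡ 2) (exchange-restore e∈B₁ (≢-sym f≢e) (≢-sym f≢w))
          (∣T△T-x+y∣≡2 (exchange⁺ f∈B₁ f≢e) (x∉T-x+y e≢w))
      , trans (cong ∣_∣ (△-comm (B₁ - f + w) B₁)) (∣T△T-x+y∣≡2 f∈B₁ w∉B₁)
      , e∈B₁-f+w , x∉T-x+y e≢w ) ,
      x∉T-x+y f≢w , y∈T+y
      where
      f≢w : f ≢ w
      f≢w = x∈p∧y∉p⇒x≢y f∈B₁ w∉B₁
      e∈B₁-f+w : e ∈ B₁ - f + w
      e∈B₁-f+w = exchange⁺ e∈B₁ (≢-sym f≢e)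
      g∉B₁-e+w : g ∉ B₁ - e + w
      g∉B₁-e+w = exchange-∉ g∉B₁ (≢-sym w≢g)
      g∉B₁-f+w : g ∉ B₁ - f + w
      g∉B₁-f+w = exchange-∉ g∉B₁ (≢-sym w≢g)

    good-cycle-via-g : ∀ {f} → f ∈ B₁ → f ≢ e → crosses (cut f) g ≡ true →
      crosses (cut e) w xor crosses (cut f) w ≡ true → GoodCycleThrough e B₁ (B₁ - e + g) w
    good-cycle-via-g {f} f∈B₁ f≢e g-crosses-f w-crosses-one =
      f , f∈B₁ , f≢e , B₁ - f + g - e + w , B₁ - f + g ,
      ( B₁-basis , B₂-basis
      , fundamentalCuts⇒basis (exchange-fundamentalCuts B₄-cuts e∈B₁-f+g w∉B₁-f+g w-crosses-e′)
      , fundamentalCuts⇒basis B₄-cuts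
      , x∉p∧x∈q⇒p≢q g∉B₁ y∈T+y , x∉p∧x∈q⇒p≢q w∉B₁ y∈T+y , x∉p∧x∈q⇒p≢q g∉B₁ y∈T+y
      , x∉p∧x∈q⇒p≢q w∉B₁-e+g y∈T+y , x∈p∧x∉q⇒p≢q f∈B₁-e+g (x∉T-x+y f≢g)
      , x∈p∧x∉q⇒p≢q y∈T+y w∉B₁-f+g
      , ∣T△T-x+y∣≡2 e∈B₁ g∉B₁
      , subst (λ B → ∣ (B₁ - e + g) △ B ∣ ≡ 2) (exchange-comm e≢g f≢g) (∣T△T-x+y∣≡2 f∈B₁-e+g w∉B₁-e+g)
      , trans (cong ∣_∣ (△-comm (B₁ - f + g - e + w) (B₁ - f + g))) (∣T△T-x+y∣≡2 e∈B₁-f+g w∉B₁-f+g)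
      , trans (cong ∣_∣ (△-comm (B₁ - f + g) B₁)) (∣T△T-x+y∣≡2 f∈B₁ g∉B₁)
      , e∈B₁-f+g , x∉T-x+y e≢w ) ,
      x∉T-x+y f≢g , y∈T+y
      where
      f≢g : f ≢ g
      f≢g = x∈p∧y∉p⇒x≢y f∈B₁ g∉B₁
      e∈B₁-f+g : e ∈ B₁ - f + g
      e∈B₁-f+g = exchange⁺ e∈B₁ (≢-sym f≢e)
      f∈B₁-e+g : f ∈ B₁ - e + g
      f∈B₁-e+g = exchange⁺ f∈B₁ f≢e
      w∉B₁-f+g : w ∉ B₁ - f + g
      w∉B₁-f+g = exchange-∉ w∉B₁ w≢g
      w∉B₁-e+g : w ∉ B₁ - e + g
      w∉B₁-e+g = exchange-∉ w∉B₁ w≢g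
      B₄-cuts : FundamentalCuts (B₁ - f + g) (exchangeCuts cut f g)
      B₄-cuts = exchange-fundamentalCuts cuts f∈B₁ g∉B₁ g-crosses-f
      w-crosses-e′ : crosses (exchangeCuts cut f g e) w ≡ true
      w-crosses-e′ rewrite crosses-exchangeCuts cut f g e e≢g w | g-crosses-e = w-crosses-one

    good-cycle : ∀ {f} → f ∈ B₁ → f ≢ e → crosses (cut f) g ≡ true →
      crosses (cut e) w ∨ crosses (cut f) w ≡ true → GoodCycleThrough e B₁ (B₁ - e + g) w
    good-cycle {f} f∈B₁ f≢e g-crosses-f w-crosses-some
      with crosses (cut e) w in w-e | crosses (cut f) w in w-f
    ... | true  | true  = good-cycle-via-w f∈B₁ f≢e w-e w-f
    ... | true  | false = good-cycle-via-g f∈B₁ f≢e g-crosses-f (cong₂ _xor_ w-e w-f)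
    ... | false | true  = good-cycle-via-g f∈B₁ f≢e g-crosses-f (cong₂ _xor_ w-e w-f)
    ... | false | false with () ← w-crosses-some

proposition2p8 : (G : Graph) → TwoEdgeConnected G →
    (B₁ B₂ : EdgeSet G) (e g : E G) →
    IsBasis G B₁ → IsBasis G B₂ →
    e ∈ B₁ → g ∉ B₁ → B₂ ≡ (B₁ - e) ∪ ⁅ g ⁆ →
    (C : EdgeSet G) → IsCycle G C → C ⊆ (B₁ ∪ ⁅ g ⁆) →
    3 ≤ ∣ C ∣ →
    (w : E G) → w ∉ B₁ → w ≢ g →
    OnVertexSet G (proj₁ (Graph.ends G w)) C →
    OnVertexSet G (proj₂ (Graph.ends G w)) C →
    Σ (E G) λ f → f ∈ B₁ × f ≢ e ×
      Σ (EdgeSet G) λ B₃ → Σ (EdgeSet G) λ B₄ →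
        GoodCycle G e B₁ B₂ B₃ B₄ × f ∉ B₄ × w ∈ B₃
proposition2p8 G _ B₁ _ e g B₁-basis B₂-basis e∈B₁ g∉B₁ refl
               C C-cycle C⊆B₁+g 3≤∣C∣ w w∉B₁ w≢g w₁-on w₂-on
  = let _ , f∈B₁ , f≢e , g-crosses-f , w-crosses-e-or-f = witness
    in good-cycle f∈B₁ f≢e g-crosses-f w-crosses-e-or-f
  where
  cut : E G → V G → Bool
  cut = side G (proj₁ B₁-basis)
  cuts : FundamentalCuts G B₁ cut
  cuts = basis⇒fundamentalCuts G B₁-basis
  open FundamentalCuts cuts
  open GoodCycles G cuts B₂-basis e∈B₁ g∉B₁ w∉B₁ w≢g

  witness : Σ (E G) λ f → f ∈ B₁ × f ≢ e × crosses G (cut f) g ≡ true ×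
    crosses G (cut e) w ∨ crosses G (cut f) w ≡ true
  witness with crosses G (cut e) w in w-e
  ... | true with f , f∈C , f≢e , f≢g ← ∣p∣≥3⇒∃∉⁅x,y⁆ C e g 3≤∣C∣ =
    f , f∈B₁ , f≢e ,
    cycle-separated⇒crosses G cuts C-cycle C⊆B₁+g f∈B₁ (f , f∈C , inj₁ refl) (f , f∈C , inj₂ refl)
      (xor≡true⇒≢ _ _ (crosses-own f f∈B₁)) ,
    refl
    where
    f∈B₁ : f ∈ B₁
    f∈B₁ = x∈p+y∧x≢y⇒x∈p (C⊆B₁+g f∈C) f≢g
  ... | false with f , f∈B₁ , f-separates ← separating-cut G cuts (Graph.loopless G w) =
    f , f∈B₁ , (λ { refl → f-separates (xor≡false⇒≡ _ _ w-e) }) ,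
    cycle-separated⇒crosses G cuts C-cycle C⊆B₁+g f∈B₁ w₁-on w₂-on f-separates ,
    ≢⇒xor≡true _ _ f-separates
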